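{- Let $m,n,k\in\mathbb{Z}$ with $m\ge n\ge0$ and $-k\notin\{0,1,\ldots,m\}$. Then \[P_{n,-k}=k\binom{m+k}{m}\sum_{j=0}^m(-1)^j\frac{1}{k+j}\binom mj P_{n,j}.\]
   Context: $\mathbb{K}$ is a field of characteristic zero; for integers $N$ and $m\ge0$, $\binom Nm=N(N-1)\cdots(N-m+1)/m!$. Partial Bell polynomials: $B_{0,0}=1$, $B_{n,0}=0$ ($n\ge1$), $B_{n,j}=0$ ($j>n$), and for $1\le j\le n$, $B_{n,j}=\sum\frac{n!}{\prod_ir_i!(i!)^{r_i}}\prod_iX_i^{r_i}$ over non-negative integers $r_i$ with $\sum r_i=j$, $\sum ir_i=n$. The potential polynomials are $P_{n,r}:=\sum_{j=0}^n r(r-1)\cdots(r-j+1)\,B_{n,j}\in\mathbb{K}[X_1,\ldots,X_n]$ for $n\ge0$, $r\in\mathbb{Z}$. -}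

module Defs where

open import Level using (_⊔_)
open import Algebra.Bundles using (CommutativeRing)
open import Data.Nat as ℕ using (ℕ; zero; suc; _≡ᵇ_; _<ᵇ_)
open import Data.Nat.Base using (_!)
open import Data.Integer as ℤ using (ℤ; +_; -[1+_])
open import Data.Bool using (Bool; true; false; if_then_else_; _∧_)
open import Data.List using (List; []; _∷_; [_]; map; concatMap; upTo)
open import Data.Vec using (Vec; []; _∷_)
open import Relation.Nullary using (¬_)

natR : ∀ {c ℓ} (R : CommutativeRing c ℓ) → ℕ → CommutativeRing.Carrier R
natR R zero    = CommutativeRing.0# R
natR R (suc n) = CommutativeRing._+_ R (CommutativeRing.1# R) (natR R n)

-- A field of characteristic zero.  The inverse is totalised (the value of
-- 0 ⁻¹ is unconstrained); for x ≉ 0 it is the multiplicative inverse.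
record CharZeroField (c ℓ : Level.Level) : Set (Level.suc (c ⊔ ℓ)) where
  field
    cring     : CommutativeRing c ℓ
  open CommutativeRing cring
  field
    _⁻¹      : Carrier → Carrier
    inverse  : ∀ x → ¬ (x ≈ 0#) → (x * (x ⁻¹)) ≈ 1#
    charZero : ∀ n → ¬ (natR cring (suc n) ≈ 0#)

module Over {c ℓ} (F : CharZeroField c ℓ) where
  open CharZeroField F
  open CommutativeRing cring

  nat : ℕ → Carrier
  nat = natR cring

  int : ℤ → Carrier
  int (+ n)      = nat n
  int -[1+ n ]   = - nat (suc n)

  pow : Carrier → ℕ → Carrier
  pow x zero    = 1#
  pow x (suc n) = x * pow x n

  sumTo : ℕ → (ℕ → Carrier) → Carrier
  sumTo zero    f = f 0
  sumTo (suc n) f = sumTo n f + f (suc n)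

  sumList : List Carrier → Carrier
  sumList []       = 0#
  sumList (a ∷ as) = a + sumList as

  fall : ℤ → ℕ → ℤ
  fall N zero    = + 1
  fall N (suc j) = fall N j ℤ.* (N ℤ.- + j)

  binom : ℤ → ℕ → Carrier
  binom N m = int (fall N m) * (nat (m !) ⁻¹)

  allVecs : (n b : ℕ) → List (Vec ℕ n)
  allVecs zero    b = [ [] ]
  allVecs (suc n) b = concatMap (λ v → map (λ a → a ∷ v) (upTo (suc b))) (allVecs n b)

  -- For r = (r₁,…,r_l) stored with rᵢ at position i-1 (offset o = i-1 of the first entry):
  --   Σ rᵢ,  Σ i·rᵢ,  Π rᵢ! (i!)^{rᵢ} (as a natural number),  Π X_i^{rᵢ} evaluated at x
  sumR : ∀ {l} → Vec ℕ l → ℕ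
  sumR []       = 0
  sumR (r ∷ rs) = r ℕ.+ sumR rs

  sumIR : ∀ {l} → ℕ → Vec ℕ l → ℕ
  sumIR o []       = 0
  sumIR o (r ∷ rs) = suc o ℕ.* r ℕ.+ sumIR (suc o) rs

  denom : ∀ {l} → ℕ → Vec ℕ l → ℕ
  denom o []       = 1
  denom o (r ∷ rs) = (r !) ℕ.* ((suc o !) ℕ.^ r) ℕ.* denom (suc o) rs

  mono : ∀ {l} → (ℕ → Carrier) → ℕ → Vec ℕ l → Carrier
  mono x o []       = 1#
  mono x o (r ∷ rs) = pow (x (suc o)) r * mono x (suc o) rs

  -- the sum defining B_{n,j} for 1 ≤ j ≤ n, evaluated at X_i ↦ x i
  -- (each rᵢ is ≤ n because Σ i rᵢ = n, so enumerating rᵢ ∈ {0..n} is exhaustive;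
  --  rᵢ for i > n are forced to be 0)
  bellSum : (n j : ℕ) → (ℕ → Carrier) → Carrier
  bellSum n j x = sumList (map term (allVecs n n))
    where
    term : Vec ℕ n → Carrier
    term r = if (sumR r ≡ᵇ j) ∧ (sumIR 0 r ≡ᵇ n)
             then (nat (n !) * (nat (denom 0 r) ⁻¹)) * mono x 0 r
             else 0#

  B : (n j : ℕ) → (ℕ → Carrier) → Carrier
  B zero    zero    x = 1#
  B (suc n) zero    x = 0#
  B n (suc j) x = if n <ᵇ suc j then 0# else bellSum n (suc j) x

  P : ℕ → ℤ → (ℕ → Carrier) → Carrier
  P n r x = sumTo n (λ j → int (fall r j) * B n j x)

-- P_{n,r} = Σ_d r(r-1)⋯(r-d+1) B_{n,d}, so it suffices to prove the identity with P_{n,r}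
-- replaced by the falling factorial r^{(d)} for each d ≤ n ≤ m.  Multiplying by
-- k(k+1)⋯(k+m) = m! k C(m+k,m) clears the denominators k + j and leaves the integer identity
--   Σ_j (-1)^j C(m,j) j^{(d)} ∏_{i≤m, i≠j} (k+i) = m! (-k)^{(d)}.
-- It is proved by induction on d: writing j − d = (k + j) − (k + d) reduces step d+1 to step d
-- and to the vanishing of alternating binomial sums of polynomials of degree < m; the case
-- d = 0 follows by induction on m from Pascal's rule.
module Submission where

open import Defs
open import Algebra.Bundles using (CommutativeRing)
open import Data.Nat as ℕ using (ℕ; _≤_; zero; suc; _<_; z≤n; s≤s; _!)
open import Data.Integer as ℤ using (ℤ; +_; -[1+_])
open import Relation.Binary.PropositionalEquality using (_≢_)
open import Relation.Nullary using (¬_; contradiction)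
import Data.Nat.Properties as ℕ
import Data.Integer.Properties as ℤ
import Relation.Binary.PropositionalEquality as ≡
open ≡ using (_≡_)

module AlternatingSum where
  open import Data.Integer using (_+_; _*_; -_; _-_; 0ℤ; 1ℤ)
  open import Data.Integer.Tactic.RingSolver using (solve-∀)
  open import Algebra.Properties.AbelianGroup ℤ.+-0-abelianGroup using (inverseʳ-unique)
  open import Algebra.Properties.CommutativeSemigroup ℤ.+-commutativeSemigroup using (interchange)
  open ≡ using (refl; sym; trans; cong; cong₂)
  open ≡.≡-Reasoning

  sumTo : ℕ → (ℕ → ℤ) → ℤ
  sumTo zero    f = f 0
  sumTo (suc m) f = sumTo m f + f (suc m)

  sumTo-cong : ∀ m {f g : ℕ → ℤ} → (∀ j → j ≤ m → f j ≡ g j) → sumTo m f ≡ sumTo m g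
  sumTo-cong zero    f≡g = f≡g 0 z≤n
  sumTo-cong (suc m) f≡g =
    cong₂ _+_ (sumTo-cong m (λ j j≤m → f≡g j (ℕ.m≤n⇒m≤1+n j≤m))) (f≡g (suc m) ℕ.≤-refl)

  sumTo-+ : ∀ m (f g : ℕ → ℤ) → sumTo m (λ j → f j + g j) ≡ sumTo m f + sumTo m g
  sumTo-+ zero    f g = refl
  sumTo-+ (suc m) f g = trans (cong (_+ (f (suc m) + g (suc m))) (sumTo-+ m f g))
                              (interchange (sumTo m f) (sumTo m g) (f (suc m)) (g (suc m)))

  *-distribˡ-sumTo : ∀ m c (f : ℕ → ℤ) → c * sumTo m f ≡ sumTo m (λ j → c * f j)
  *-distribˡ-sumTo zero    c f = refl
  *-distribˡ-sumTo (suc m) c f =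
    trans (ℤ.*-distribˡ-+ c (sumTo m f) (f (suc m))) (cong (_+ c * f (suc m)) (*-distribˡ-sumTo m c f))

  sumTo-suc-head : ∀ m (f : ℕ → ℤ) → sumTo (suc m) f ≡ f 0 + sumTo m (λ j → f (suc j))
  sumTo-suc-head zero    f = refl
  sumTo-suc-head (suc m) f =
    trans (cong (_+ f (suc (suc m))) (sumTo-suc-head m f)) (ℤ.+-assoc (f 0) _ _)

  sign : ℕ → ℤ
  sign zero    = 1ℤ
  sign (suc j) = - sign j

  choose : ℕ → ℕ → ℤ
  choose zero    zero    = 1ℤ
  choose zero    (suc j) = 0ℤ
  choose (suc m) zero    = 1ℤ
  choose (suc m) (suc j) = choose m j + choose m (suc j)

  choose-zeroʳ : ∀ m → choose m 0 ≡ 1ℤ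
  choose-zeroʳ zero    = refl
  choose-zeroʳ (suc m) = refl

  m<j⇒choose≡0 : ∀ {m j} → m < j → choose m j ≡ 0ℤ
  m<j⇒choose≡0 {zero}  {suc j} _         = refl
  m<j⇒choose≡0 {suc m} {suc j} (s≤s m<j) =
    cong₂ _+_ (m<j⇒choose≡0 m<j) (m<j⇒choose≡0 (ℕ.m≤n⇒m≤1+n m<j))

  alt : ℕ → (ℕ → ℤ) → ℤ
  alt m f = sumTo m (λ j → sign j * choose m j * f j)

  alt-cong : ∀ m {f g : ℕ → ℤ} → (∀ j → j ≤ m → f j ≡ g j) → alt m f ≡ alt m g
  alt-cong m f≡g = sumTo-cong m (λ j j≤m → cong (sign j * choose m j *_) (f≡g j j≤m))

  alt-+ : ∀ m (f g : ℕ → ℤ) → alt m (λ j → f j + g j) ≡ alt m f + alt m g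
  alt-+ m f g = trans (sumTo-cong m (λ j _ → ℤ.*-distribˡ-+ (sign j * choose m j) (f j) (g j)))
                      (sumTo-+ m _ _)

  alt-*ˡ : ∀ m c (f : ℕ → ℤ) → alt m (λ j → c * f j) ≡ c * alt m f
  alt-*ˡ m c f = trans (sumTo-cong m (λ j _ → swap (sign j * choose m j) c (f j)))
                       (sym (*-distribˡ-sumTo m c _))
    where
    swap : ∀ a c b → a * (c * b) ≡ c * (a * b)
    swap = solve-∀

  -- Pascal's rule splits each term; the C(m,j) halves reassemble into alt m f since C(m,m+1) = 0.
  alt-suc : ∀ m (f : ℕ → ℤ) → alt (suc m) f ≡ alt m f - alt m (λ j → f (suc j))
  alt-suc m f = begin
    alt (suc m) f
      ≡⟨ sumTo-suc-head m _ ⟩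
    1ℤ * 1ℤ * f 0 + sumTo m (λ j → - sign j * (choose m j + choose m (suc j)) * f (suc j))
      ≡⟨ cong₂ _+_ (cong (λ c → 1ℤ * c * f 0) (sym (choose-zeroʳ m)))
                   (trans (sumTo-cong m (λ j _ → pascal (sign j) _ _ (f (suc j)))) (sumTo-+ m _ _)) ⟩
    g 0 + (sumTo m (λ j → g (suc j)) + sumTo m (λ j → - 1ℤ * (sign j * choose m j * f (suc j))))
      ≡⟨ cong (λ b → g 0 + (sumTo m (λ j → g (suc j)) + b))
              (sym (*-distribˡ-sumTo m (- 1ℤ) (λ j → sign j * choose m j * f (suc j)))) ⟩
    g 0 + (sumTo m (λ j → g (suc j)) + - 1ℤ * alt m (λ j → f (suc j)))
      ≡⟨ sym (ℤ.+-assoc (g 0) _ _) ⟩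
    g 0 + sumTo m (λ j → g (suc j)) + - 1ℤ * alt m (λ j → f (suc j))
      ≡⟨ cong (_+ - 1ℤ * alt m (λ j → f (suc j))) (sym (sumTo-suc-head m g)) ⟩
    sumTo m g + g (suc m) + - 1ℤ * alt m (λ j → f (suc j))
      ≡⟨ cong (λ z → sumTo m g + sign (suc m) * z * f (suc m) + - 1ℤ * alt m (λ j → f (suc j)))
              (m<j⇒choose≡0 {m} ℕ.≤-refl) ⟩
    alt m f + sign (suc m) * 0ℤ * f (suc m) + - 1ℤ * alt m (λ j → f (suc j))
      ≡⟨ tidy (alt m f) (sign (suc m)) (f (suc m)) _ ⟩
    alt m f - alt m (λ j → f (suc j)) ∎
    where
    g : ℕ → ℤ
    g j = sign j * choose m j * f j
    pascal : ∀ s a b x → - s * (a + b) * x ≡ - s * b * x + - 1ℤ * (s * a * x)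
    pascal = solve-∀
    tidy : ∀ a s x b → a + s * 0ℤ * x + - 1ℤ * b ≡ a - b
    tidy = solve-∀

  falling : ℤ → ℕ → ℤ
  falling N zero    = 1ℤ
  falling N (suc j) = falling N j * (N - + j)

  falling-zero : ∀ j → falling 0ℤ (suc j) ≡ 0ℤ
  falling-zero zero    = refl
  falling-zero (suc j) = trans (cong (_* (0ℤ - + suc j)) (falling-zero j)) (ℤ.*-zeroˡ (0ℤ - + suc j))

  falling-suc : ∀ x j → falling (1ℤ + x) (suc j) ≡ falling x (suc j) + + suc j * falling x j
  falling-suc x zero    = base x
    where
    base : ∀ x → 1ℤ * (1ℤ + x - + 0) ≡ 1ℤ * (x - + 0) + + 1 * 1ℤ
    base = solve-∀
  falling-suc x (suc j) =
    trans (cong (_* (1ℤ + x - + suc j)) (falling-suc x j)) (step (falling x j) x (+ j))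
    where
    step : ∀ a x n → (a * (x - n) + (1ℤ + n) * a) * (1ℤ + x - (1ℤ + n))
                   ≡ a * (x - n) * (x - (1ℤ + n)) + (1ℤ + (1ℤ + n)) * (a * (x - n))
    step = solve-∀

  choose*!≡falling : ∀ m j → choose m j * + (j !) ≡ falling (+ m) j
  choose*!≡falling zero    zero    = refl
  choose*!≡falling zero    (suc j) = trans (ℤ.*-zeroˡ (+ (suc j !))) (sym (falling-zero j))
  choose*!≡falling (suc m) zero    = refl
  choose*!≡falling (suc m) (suc j) = begin
    (choose m j + choose m (suc j)) * + (suc j !)
      ≡⟨ cong ((choose m j + choose m (suc j)) *_) (ℤ.pos-* (suc j) (j !)) ⟩
    (choose m j + choose m (suc j)) * (+ suc j * + (j !))
      ≡⟨ regroup (choose m j) (choose m (suc j)) (+ suc j) (+ (j !)) ⟩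
    choose m (suc j) * (+ suc j * + (j !)) + + suc j * (choose m j * + (j !))
      ≡⟨ cong₂ _+_ (trans (cong (choose m (suc j) *_) (sym (ℤ.pos-* (suc j) (j !))))
                          (choose*!≡falling m (suc j)))
                   (cong (+ suc j *_) (choose*!≡falling m j)) ⟩
    falling (+ m) (suc j) + + suc j * falling (+ m) j
      ≡⟨ sym (falling-suc (+ m) j) ⟩
    falling (+ suc m) (suc j) ∎
    where
    regroup : ∀ a b c d → (a + b) * (c * d) ≡ b * (c * d) + c * (a * d)
    regroup = solve-∀

  alt-falling-< : ∀ {m d} → d < m → alt m (λ j → falling (+ j) d) ≡ 0ℤ
  alt-falling-< {suc m} {zero}  _ = trans (alt-suc m (λ _ → 1ℤ)) (ℤ.+-inverseʳ (alt m (λ _ → 1ℤ)))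
  alt-falling-< {suc m} {suc d} (s≤s d<m) = begin
    alt (suc m) (λ j → falling (+ j) (suc d))
      ≡⟨ alt-suc m _ ⟩
    a - alt m (λ j → falling (+ suc j) (suc d))
      ≡⟨ cong (_-_ a) (alt-cong m (λ j _ → falling-suc (+ j) d)) ⟩
    a - alt m (λ j → falling (+ j) (suc d) + + suc d * falling (+ j) d)
      ≡⟨ cong (_-_ a) (trans (alt-+ m _ _) (cong (_+_ a) (alt-*ˡ m (+ suc d) _))) ⟩
    a - (a + + suc d * alt m (λ j → falling (+ j) d))
      ≡⟨ cong (λ e → a - (a + + suc d * e)) (alt-falling-< d<m) ⟩
    a - (a + + suc d * 0ℤ)
      ≡⟨ cancel a (+ suc d) ⟩
    0ℤ ∎
    where
    a : ℤ
    a = alt m (λ j → falling (+ j) (suc d))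
    cancel : ∀ a b → a - (a + b * 0ℤ) ≡ 0ℤ
    cancel = solve-∀

  rising : ℤ → ℕ → ℤ
  rising k zero    = 1ℤ
  rising k (suc m) = k * rising (k + 1ℤ) m

  rising-suc : ∀ k m → rising k (suc m) ≡ rising k m * (k + + m)
  rising-suc k zero    = lemma k
    where
    lemma : ∀ k → k * 1ℤ ≡ 1ℤ * (k + + 0)
    lemma = solve-∀
  rising-suc k (suc m) =
    trans (cong (k *_) (rising-suc (k + 1ℤ) m)) (lemma k (rising (k + 1ℤ) m) (+ m))
    where
    lemma : ∀ k a n → k * (a * (k + 1ℤ + n)) ≡ k * a * (k + (1ℤ + n))
    lemma = solve-∀

  falling≡rising : ∀ N m → falling N m ≡ rising (N - + m + 1ℤ) m
  falling≡rising N zero    = refl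
  falling≡rising N (suc m) = begin
    falling N m * (N - + m)                 ≡⟨ cong (_* (N - + m)) (falling≡rising N m) ⟩
    rising (N - + m + 1ℤ) m * (N - + m)     ≡⟨ ℤ.*-comm _ (N - + m) ⟩
    rising (N - + m) (suc m)                ≡⟨ cong (λ b → rising b (suc m)) (lemma N (+ m)) ⟩
    rising (N - + suc m + 1ℤ) (suc m)       ∎
    where
    lemma : ∀ N n → N - n ≡ N - (1ℤ + n) + 1ℤ
    lemma = solve-∀

  *-falling≡rising : ∀ k m → k * falling (+ m + k) m ≡ rising k (suc m)
  *-falling≡rising k m = cong (k *_) (trans (falling≡rising (+ m + k) m)
                                            (cong (λ b → rising b m) (lemma (+ m) k)))
    where
    lemma : ∀ n k → n + k - n + 1ℤ ≡ k + 1ℤ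
    lemma = solve-∀

  -- risingWithout k m j = ∏_{i ≤ m, i ≠ j} (k + i).
  risingWithout : ℤ → ℕ → ℕ → ℤ
  risingWithout k m       zero    = rising (k + 1ℤ) m
  risingWithout k zero    (suc j) = k
  risingWithout k (suc m) (suc j) = k * risingWithout (k + 1ℤ) m j

  risingWithout*≡rising : ∀ k {m j} → j ≤ m → risingWithout k m j * (k + + j) ≡ rising k (suc m)
  risingWithout*≡rising k {m} {zero} _ = lemma k (rising (k + 1ℤ) m)
    where
    lemma : ∀ k a → a * (k + + 0) ≡ k * a
    lemma = solve-∀
  risingWithout*≡rising k {suc m} {suc j} (s≤s j≤m) = begin
    k * risingWithout (k + 1ℤ) m j * (k + + suc j)
      ≡⟨ lemma k (risingWithout (k + 1ℤ) m j) (+ j) ⟩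
    k * (risingWithout (k + 1ℤ) m j * (k + 1ℤ + + j))
      ≡⟨ cong (k *_) (risingWithout*≡rising (k + 1ℤ) j≤m) ⟩
    k * rising (k + 1ℤ) (suc m) ∎
    where
    lemma : ∀ k a n → k * a * (k + (1ℤ + n)) ≡ k * (a * (k + 1ℤ + n))
    lemma = solve-∀

  risingWithout-suc : ∀ k {m j} → j ≤ m →
                      risingWithout k (suc m) j ≡ (k + + suc m) * risingWithout k m j
  risingWithout-suc k {m} {zero} _ =
    trans (rising-suc (k + 1ℤ) m) (lemma k (+ m) (rising (k + 1ℤ) m))
    where
    lemma : ∀ k n a → a * (k + 1ℤ + n) ≡ (k + (1ℤ + n)) * a
    lemma = solve-∀
  risingWithout-suc k {suc m} {suc j} (s≤s j≤m) = begin
    k * risingWithout (k + 1ℤ) (suc m) j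
      ≡⟨ cong (k *_) (risingWithout-suc (k + 1ℤ) j≤m) ⟩
    k * ((k + 1ℤ + + suc m) * risingWithout (k + 1ℤ) m j)
      ≡⟨ lemma k (+ m) (risingWithout (k + 1ℤ) m j) ⟩
    (k + + suc (suc m)) * (k * risingWithout (k + 1ℤ) m j) ∎
    where
    lemma : ∀ k n a → k * ((k + 1ℤ + (1ℤ + n)) * a) ≡ (k + (1ℤ + (1ℤ + n))) * (k * a)
    lemma = solve-∀

  alt-risingWithout : ∀ k m → alt m (risingWithout k m) ≡ + (m !)
  alt-risingWithout k zero    = refl
  alt-risingWithout k (suc m) = begin
    alt (suc m) (risingWithout k (suc m))
      ≡⟨ alt-suc m _ ⟩
    alt m (risingWithout k (suc m)) - alt m (λ j → k * risingWithout (k + 1ℤ) m j)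
      ≡⟨ cong₂ _-_ (trans (alt-cong m (λ j → risingWithout-suc k)) (alt-*ˡ m (k + + suc m) _))
                   (alt-*ˡ m k _) ⟩
    (k + + suc m) * alt m (risingWithout k m) - k * alt m (risingWithout (k + 1ℤ) m)
      ≡⟨ cong₂ (λ a b → (k + + suc m) * a - k * b) (alt-risingWithout k m) (alt-risingWithout (k + 1ℤ) m) ⟩
    (k + + suc m) * + (m !) - k * + (m !)
      ≡⟨ lemma k (+ m) (+ (m !)) ⟩
    + suc m * + (m !)
      ≡⟨ ℤ.pos-* (suc m) (m !) ⟨
    + (suc m !) ∎
    where
    lemma : ∀ k n a → (k + (1ℤ + n)) * a - k * a ≡ (1ℤ + n) * a
    lemma = solve-∀

  alt-falling*risingWithout : ∀ k {m d} → d ≤ m →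
    alt m (λ j → falling (+ j) d * risingWithout k m j) ≡ falling (- k) d * + (m !)
  alt-falling*risingWithout k {m} {zero} _ =
    trans (alt-cong m (λ j _ → ℤ.*-identityˡ _)) (trans (alt-risingWithout k m) (sym (ℤ.*-identityˡ _)))
  alt-falling*risingWithout k {m} {suc d} d<m = begin
    alt m (λ j → falling (+ j) d * (+ j - + d) * risingWithout k m j)
      ≡⟨ alt-cong m (λ j j≤m → trans (split (falling (+ j) d) (+ j) (+ d) k (risingWithout k m j))
                                     (cong (λ r → r * falling (+ j) d + rest j)
                                           (risingWithout*≡rising k j≤m))) ⟩
    alt m (λ j → R * falling (+ j) d + - (k + + d) * (falling (+ j) d * risingWithout k m j))
      ≡⟨ trans (alt-+ m _ _) (cong₂ _+_ (alt-*ˡ m R _) (alt-*ˡ m (- (k + + d)) _)) ⟩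
    R * alt m (λ j → falling (+ j) d) + - (k + + d) * alt m (λ j → falling (+ j) d * risingWithout k m j)
      ≡⟨ cong₂ (λ a b → R * a + - (k + + d) * b)
               (alt-falling-< d<m) (alt-falling*risingWithout k (ℕ.<⇒≤ d<m)) ⟩
    R * 0ℤ + - (k + + d) * (falling (- k) d * + (m !))
      ≡⟨ collect R k (+ d) (+ (m !)) (falling (- k) d) ⟩
    falling (- k) d * (- k - + d) * + (m !) ∎
    where
    R : ℤ
    R = rising k (suc m)
    rest : ℕ → ℤ
    rest j = - (k + + d) * (falling (+ j) d * risingWithout k m j)
    split : ∀ a j d k q → a * (j - d) * q ≡ (q * (k + j)) * a + - (k + d) * (a * q)
    split = solve-∀
    collect : ∀ r k d M f → r * 0ℤ + - (k + d) * (f * M) ≡ f * (- k - d) * M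
    collect = solve-∀

  -k≢j⇒k+j≢0 : ∀ k j → - k ≢ j → k + j ≢ 0ℤ
  -k≢j⇒k+j≢0 k j -k≢j k+j≡0 = -k≢j (sym (inverseʳ-unique k j k+j≡0))

module PotentialPolynomials {c ℓ} (F : CharZeroField c ℓ) where
  open CharZeroField F
  open CommutativeRing cring
  open Over F
  open AlternatingSum
    using (sign; choose; falling; rising; risingWithout; alt; choose*!≡falling; *-falling≡rising;
           risingWithout*≡rising; alt-falling*risingWithout; -k≢j⇒k+j≢0)
    renaming (sumTo to sumToℤ)
  open import Algebra.Properties.Ring ring
    using (-‿involutive; -‿distribˡ-*; -‿distribʳ-*; -‿+-comm; -0#≈0#; -1*x≈-x)
  open import Algebra.Properties.CommutativeSemigroup +-commutativeSemigroup using (interchange)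
  open import Algebra.Properties.Semiring.Mult semiring using (_×_; ×-homo-+; ×1-homo-*)
  open import Algebra.Solver.Ring.NaturalCoefficients.Default commutativeSemiring
    using (solve; _:=_; _:*_)
  open import Relation.Binary.Reasoning.Setoid setoid

  nat≈×1# : ∀ n → nat n ≈ n × 1#
  nat≈×1# zero    = refl
  nat≈×1# (suc n) = +-congˡ (nat≈×1# n)

  nat-+ : ∀ a b → nat (a ℕ.+ b) ≈ nat a + nat b
  nat-+ a b = begin
    nat (a ℕ.+ b)        ≈⟨ nat≈×1# (a ℕ.+ b) ⟩
    (a ℕ.+ b) × 1#       ≈⟨ ×-homo-+ 1# a b ⟩
    a × 1# + b × 1#      ≈⟨ +-cong (nat≈×1# a) (nat≈×1# b) ⟨
    nat a + nat b        ∎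

  nat-* : ∀ a b → nat (a ℕ.* b) ≈ nat a * nat b
  nat-* a b = begin
    nat (a ℕ.* b)        ≈⟨ nat≈×1# (a ℕ.* b) ⟩
    (a ℕ.* b) × 1#       ≈⟨ ×1-homo-* a b ⟩
    a × 1# * b × 1#      ≈⟨ *-cong (nat≈×1# a) (nat≈×1# b) ⟨
    nat a * nat b        ∎

  int-⊖ : ∀ a b → int (a ℤ.⊖ b) ≈ nat a - nat b
  int-⊖ a       zero    = begin
    int (a ℤ.⊖ 0)      ≡⟨ ≡.cong int (ℤ.⊖-≥ {a} z≤n) ⟩
    nat a              ≈⟨ +-identityʳ (nat a) ⟨
    nat a + 0#         ≈⟨ +-congˡ -0#≈0# ⟨
    nat a - nat 0      ∎
  int-⊖ zero    (suc b) = sym (+-identityˡ _)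
  int-⊖ (suc a) (suc b) = begin
    int (suc a ℤ.⊖ suc b)            ≡⟨ ≡.cong int (ℤ.[1+m]⊖[1+n]≡m⊖n a b) ⟩
    int (a ℤ.⊖ b)                    ≈⟨ int-⊖ a b ⟩
    nat a - nat b                    ≈⟨ +-identityˡ _ ⟨
    0# + (nat a - nat b)             ≈⟨ +-congʳ (-‿inverseʳ 1#) ⟨
    (1# - 1#) + (nat a - nat b)      ≈⟨ interchange 1# (nat a) (- 1#) (- nat b) ⟨
    nat (suc a) + (- 1# - nat b)     ≈⟨ +-congˡ (-‿+-comm 1# (nat b)) ⟩
    nat (suc a) - nat (suc b)        ∎

  int-+ : ∀ a b → int (a ℤ.+ b) ≈ int a + int b
  int-+ (+ a)      (+ b)      = nat-+ a b
  int-+ (+ a)      -[1+ b ]   = int-⊖ a (suc b)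
  int-+ -[1+ a ]   (+ b)      = trans (int-⊖ b (suc a)) (+-comm _ _)
  int-+ -[1+ a ]   -[1+ b ]   = begin
    - nat (suc (suc (a ℕ.+ b)))        ≡⟨ ≡.cong (λ n → - nat (suc n)) (ℕ.+-suc a b) ⟨
    - nat (suc a ℕ.+ suc b)            ≈⟨ -‿cong (nat-+ (suc a) (suc b)) ⟩
    - (nat (suc a) + nat (suc b))      ≈⟨ -‿+-comm _ _ ⟨
    - nat (suc a) + - nat (suc b)      ∎

  int-neg : ∀ a → int (ℤ.- a) ≈ - int a
  int-neg (+ zero)  = sym -0#≈0#
  int-neg (+ suc n) = refl
  int-neg -[1+ n ]  = sym (-‿involutive _)

  int-+* : ∀ a b → int (+ a ℤ.* b) ≈ nat a * int b
  int-+* a (+ b)    = trans (reflexive (≡.cong int (≡.sym (ℤ.pos-* a b)))) (nat-* a b)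
  int-+* a -[1+ b ] = begin
    int (+ a ℤ.* ℤ.- + suc b)      ≡⟨ ≡.cong int (ℤ.neg-distribʳ-* (+ a) (+ suc b)) ⟨
    int (ℤ.- (+ a ℤ.* + suc b))    ≈⟨ int-neg (+ a ℤ.* + suc b) ⟩
    - int (+ a ℤ.* + suc b)        ≈⟨ -‿cong (int-+* a (+ suc b)) ⟩
    - (nat a * nat (suc b))        ≈⟨ -‿distribʳ-* _ _ ⟩
    nat a * - nat (suc b)          ∎

  int-* : ∀ a b → int (a ℤ.* b) ≈ int a * int b
  int-* (+ a)    b = int-+* a b
  int-* -[1+ a ] b = begin
    int (ℤ.- + suc a ℤ.* b)        ≡⟨ ≡.cong int (ℤ.neg-distribˡ-* (+ suc a) b) ⟨
    int (ℤ.- (+ suc a ℤ.* b))      ≈⟨ int-neg (+ suc a ℤ.* b) ⟩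
    - int (+ suc a ℤ.* b)          ≈⟨ -‿cong (int-+* (suc a) b) ⟩
    - (nat (suc a) * int b)        ≈⟨ -‿distribˡ-* _ _ ⟩
    - nat (suc a) * int b          ∎

  int-sumTo : ∀ m (f : ℕ → ℤ) → int (sumToℤ m f) ≈ sumTo m (λ j → int (f j))
  int-sumTo zero    f = refl
  int-sumTo (suc m) f = trans (int-+ (sumToℤ m f) (f (suc m))) (+-congʳ (int-sumTo m f))

  pow-sign : ∀ j → pow (- 1#) j ≈ int (sign j)
  pow-sign zero    = sym (+-identityʳ 1#)
  pow-sign (suc j) = begin
    - 1# * pow (- 1#) j     ≈⟨ *-congˡ (pow-sign j) ⟩
    - 1# * int (sign j)     ≈⟨ -1*x≈-x _ ⟩
    - int (sign j)          ≈⟨ int-neg (sign j) ⟨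
    int (sign (suc j))      ∎

  fall≡falling : ∀ N j → fall N j ≡ falling N j
  fall≡falling N zero    = ≡.refl
  fall≡falling N (suc j) = ≡.cong (ℤ._* (N ℤ.- + j)) (fall≡falling N j)

  nat≉0 : ∀ {n} → n ≢ 0 → ¬ (nat n ≈ 0#)
  nat≉0 {zero}  0≢0 = contradiction ≡.refl 0≢0
  nat≉0 {suc n} _   = charZero n

  int≉0 : ∀ {z} → z ≢ + 0 → ¬ (int z ≈ 0#)
  int≉0 { + n }      z≢0 = nat≉0 (λ n≡0 → z≢0 (≡.cong +_ n≡0))
  int≉0 { -[1+ n ] } _ -n≈0 = charZero n (begin
    nat (suc n)        ≈⟨ -‿involutive _ ⟨
    - - nat (suc n)    ≈⟨ -‿cong -n≈0 ⟩
    - 0#               ≈⟨ -0#≈0# ⟩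
    0#                 ∎)

  n!≉0 : ∀ n → ¬ (nat (n !) ≈ 0#)
  n!≉0 n = nat≉0 (ℕ.≢-nonZero⁻¹ (n !) {{n ℕ.!≢0}})

  *-inverse-cancelʳ : ∀ {y} → ¬ (y ≈ 0#) → ∀ x → x * y * y ⁻¹ ≈ x
  *-inverse-cancelʳ {y} y≉0 x = trans (*-assoc x y (y ⁻¹)) (trans (*-congˡ (inverse y y≉0)) (*-identityʳ x))

  binom≈choose : ∀ m j → binom (+ m) j ≈ int (choose m j)
  binom≈choose m j = begin
    int (fall (+ m) j) * nat (j !) ⁻¹
      ≡⟨ ≡.cong (λ z → int z * nat (j !) ⁻¹)
                (≡.trans (fall≡falling (+ m) j) (≡.sym (choose*!≡falling m j))) ⟩
    int (choose m j ℤ.* + (j !)) * nat (j !) ⁻¹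
      ≈⟨ *-congʳ (int-* (choose m j) (+ (j !))) ⟩
    int (choose m j) * nat (j !) * nat (j !) ⁻¹
      ≈⟨ *-inverse-cancelʳ (n!≉0 j) _ ⟩
    int (choose m j) ∎

  sumTo-cong : ∀ m {f g : ℕ → Carrier} → (∀ j → j ≤ m → f j ≈ g j) → sumTo m f ≈ sumTo m g
  sumTo-cong zero    f≈g = f≈g 0 z≤n
  sumTo-cong (suc m) f≈g =
    +-cong (sumTo-cong m (λ j j≤m → f≈g j (ℕ.m≤n⇒m≤1+n j≤m))) (f≈g (suc m) ℕ.≤-refl)

  sumTo-+ : ∀ m (f g : ℕ → Carrier) → sumTo m (λ j → f j + g j) ≈ sumTo m f + sumTo m g
  sumTo-+ zero    f g = refl
  sumTo-+ (suc m) f g = trans (+-congʳ (sumTo-+ m f g)) (interchange _ _ _ _)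

  *-distribˡ-sumTo : ∀ m c (f : ℕ → Carrier) → c * sumTo m f ≈ sumTo m (λ j → c * f j)
  *-distribˡ-sumTo zero    c f = refl
  *-distribˡ-sumTo (suc m) c f = trans (distribˡ c _ _) (+-congʳ (*-distribˡ-sumTo m c f))

  *-distribʳ-sumTo : ∀ m c (f : ℕ → Carrier) → sumTo m f * c ≈ sumTo m (λ j → f j * c)
  *-distribʳ-sumTo zero    c f = refl
  *-distribʳ-sumTo (suc m) c f = trans (distribʳ c _ _) (+-congʳ (*-distribʳ-sumTo m c f))

  sumTo-swap : ∀ m n (g : ℕ → ℕ → Carrier) →
    sumTo m (λ j → sumTo n (g j)) ≈ sumTo n (λ d → sumTo m (λ j → g j d))
  sumTo-swap zero    n g = refl
  sumTo-swap (suc m) n g = trans (+-congʳ (sumTo-swap m n g)) (sym (sumTo-+ n _ _))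

  P-combination : ∀ m n (s : ℕ → ℤ) r (a : ℕ → Carrier) x →
    (∀ d → d ≤ n → sumTo m (λ j → a j * int (fall (s j) d)) ≈ int (fall r d)) →
    sumTo m (λ j → a j * P n (s j) x) ≈ P n r x
  P-combination m n s r a x coefficients = begin
    sumTo m (λ j → a j * sumTo n (λ d → int (fall (s j) d) * B n d x))
      ≈⟨ sumTo-cong m (λ j _ → trans (*-distribˡ-sumTo n (a j) _)
                                     (sumTo-cong n (λ d _ → sym (*-assoc _ _ _)))) ⟩
    sumTo m (λ j → sumTo n (λ d → a j * int (fall (s j) d) * B n d x))
      ≈⟨ sumTo-swap m n _ ⟩
    sumTo n (λ d → sumTo m (λ j → a j * int (fall (s j) d) * B n d x))
      ≈⟨ sumTo-cong n (λ d d≤n → trans (sym (*-distribʳ-sumTo m (B n d x) _))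
                                       (*-congʳ (coefficients d d≤n))) ⟩
    sumTo n (λ d → int (fall r d) * B n d x) ∎

  falling-partialFractions : ∀ m k {d} → d ≤ m → (∀ i → i ≤ m → ℤ.- k ≢ + i) →
    sumTo m (λ j → (int k * binom (+ m ℤ.+ k) m)
                   * (pow (- 1#) j * int (k ℤ.+ + j) ⁻¹ * binom (+ m) j) * int (fall (+ j) d))
      ≈ int (fall (ℤ.- k) d)
  falling-partialFractions m k {d} d≤m -k∉[0,m] = begin
    sumTo m (λ j → A * (pow (- 1#) j * I j * binom (+ m) j) * int (fall (+ j) d))
      ≈⟨ sumTo-cong m term ⟩
    sumTo m (λ j → int (sign j ℤ.* choose m j ℤ.* (falling (+ j) d ℤ.* risingWithout k m j)) * M)
      ≈⟨ *-distribʳ-sumTo m M _ ⟨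
    sumTo m (λ j → int (sign j ℤ.* choose m j ℤ.* (falling (+ j) d ℤ.* risingWithout k m j))) * M
      ≈⟨ *-congʳ (int-sumTo m _) ⟨
    int (alt m (λ j → falling (+ j) d ℤ.* risingWithout k m j)) * M
      ≡⟨ ≡.cong (λ z → int z * M) (alt-falling*risingWithout k d≤m) ⟩
    int (falling (ℤ.- k) d ℤ.* + (m !)) * M
      ≈⟨ *-congʳ (int-* (falling (ℤ.- k) d) (+ (m !))) ⟩
    int (falling (ℤ.- k) d) * nat (m !) * M
      ≈⟨ *-inverse-cancelʳ (n!≉0 m) _ ⟩
    int (falling (ℤ.- k) d)
      ≡⟨ ≡.cong int (fall≡falling (ℤ.- k) d) ⟨
    int (fall (ℤ.- k) d) ∎
    where
    A M : Carrier
    A = int k * binom (+ m ℤ.+ k) m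
    M = nat (m !) ⁻¹
    R : ℤ
    R = rising k (suc m)
    I : ℕ → Carrier
    I j = int (k ℤ.+ + j) ⁻¹

    A≈R*M : A ≈ int R * M
    A≈R*M = begin
      int k * (int (fall (+ m ℤ.+ k) m) * M)      ≈⟨ *-assoc _ _ _ ⟨
      int k * int (fall (+ m ℤ.+ k) m) * M        ≈⟨ *-congʳ (int-* k _) ⟨
      int (k ℤ.* fall (+ m ℤ.+ k) m) * M          ≡⟨ ≡.cong (λ z → int (k ℤ.* z) * M) (fall≡falling _ m) ⟩
      int (k ℤ.* falling (+ m ℤ.+ k) m) * M       ≡⟨ ≡.cong (λ z → int z * M) (*-falling≡rising k m) ⟩
      int R * M                                   ∎

    R*I≈risingWithout : ∀ {j} → j ≤ m → int R * I j ≈ int (risingWithout k m j)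
    R*I≈risingWithout {j} j≤m = begin
      int R * I j
        ≡⟨ ≡.cong (λ z → int z * I j) (≡.sym (risingWithout*≡rising k j≤m)) ⟩
      int (risingWithout k m j ℤ.* (k ℤ.+ + j)) * I j
        ≈⟨ *-congʳ (int-* (risingWithout k m j) (k ℤ.+ + j)) ⟩
      int (risingWithout k m j) * int (k ℤ.+ + j) * I j
        ≈⟨ *-inverse-cancelʳ (int≉0 (-k≢j⇒k+j≢0 k (+ j) (-k∉[0,m] j j≤m))) _ ⟩
      int (risingWithout k m j) ∎

    term : ∀ j → j ≤ m →
      A * (pow (- 1#) j * I j * binom (+ m) j) * int (fall (+ j) d)
        ≈ int (sign j ℤ.* choose m j ℤ.* (falling (+ j) d ℤ.* risingWithout k m j)) * M
    term j j≤m = begin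
      A * (pow (- 1#) j * I j * binom (+ m) j) * int (fall (+ j) d)
        ≈⟨ *-congʳ (*-congʳ A≈R*M) ⟩
      int R * M * (pow (- 1#) j * I j * binom (+ m) j) * int (fall (+ j) d)
        ≈⟨ solve 6 (λ r m s i b f → r :* m :* (s :* i :* b) :* f := s :* b :* (f :* (r :* i)) :* m)
                 refl (int R) M (pow (- 1#) j) (I j) (binom (+ m) j) (int (fall (+ j) d)) ⟩
      pow (- 1#) j * binom (+ m) j * (int (fall (+ j) d) * (int R * I j)) * M
        ≈⟨ *-congʳ (*-cong (*-cong (pow-sign j) (binom≈choose m j))
                           (*-cong (reflexive (≡.cong int (fall≡falling (+ j) d))) (R*I≈risingWithout j≤m))) ⟩
      int (sign j) * int (choose m j) * (int (falling (+ j) d) * int (risingWithout k m j)) * M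
        ≈⟨ *-congʳ (trans (int-* (sign j ℤ.* choose m j) _)
                          (*-cong (int-* (sign j) (choose m j)) (int-* (falling (+ j) d) (risingWithout k m j)))) ⟨
      int (sign j ℤ.* choose m j ℤ.* (falling (+ j) d ℤ.* risingWithout k m j)) * M ∎

theorem8p8 : ∀ {c ℓ} (F : CharZeroField c ℓ) (m n : ℕ) (k : ℤ) → n ≤ m →
    (∀ (i : ℕ) → i ≤ m → ℤ.- k ≢ + i) →
    let open CharZeroField F
        open CommutativeRing cring
        open Over F
    in ∀ (x : ℕ → Carrier) →
      P n (ℤ.- k) x
        ≈ (int k * binom (+ m ℤ.+ k) m)
          * sumTo m (λ j → pow (- 1#) j * ((int (k ℤ.+ + j)) ⁻¹) * binom (+ m) j * P n (+ j) x)
theorem8p8 F m n k n≤m -k∉[0,m] x = begin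
  P n (ℤ.- k) x
    ≈⟨ P-combination m n +_ (ℤ.- k) (λ j → A * u j) x
         (λ d d≤n → falling-partialFractions m k (ℕ.≤-trans d≤n n≤m) -k∉[0,m]) ⟨
  sumTo m (λ j → A * u j * P n (+ j) x)
    ≈⟨ sumTo-cong m (λ j _ → *-assoc A (u j) (P n (+ j) x)) ⟩
  sumTo m (λ j → A * (u j * P n (+ j) x))
    ≈⟨ *-distribˡ-sumTo m A _ ⟨
  A * sumTo m (λ j → u j * P n (+ j) x) ∎
  where
  open CharZeroField F
  open CommutativeRing cring
  open Over F
  open PotentialPolynomials F
  open import Relation.Binary.Reasoning.Setoid setoid
  A : Carrier
  A = int k * binom (+ m ℤ.+ k) m
  u : ℕ → Carrier
  u j = pow (- 1#) j * int (k ℤ.+ + j) ⁻¹ * binom (+ m) j
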